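{- Let $\mathcal{A}$ be an HDA satisfying conditions HM1 and HM2 with respect to a deterministic $\ltimes$-transition system $\mathcal{T}$ such that $\ltimes_\mathcal{T}$ is asymmetric. Let $x,y\in(P_\mathcal{A})_n$ with $n\ge2$ be such that $\{d^0_1\cdots d^0_{i-1}d^0_{i+1}\cdots d^0_nx\mid i\in\{1,\dots,n\}\}=\{d^0_1\cdots d^0_{i-1}d^0_{i+1}\cdots d^0_ny\mid i\in\{1,\dots,n\}\}$. Then $(x_\sharp)_{\le1}=(y_\sharp)_{\le1}$.
   Context: A precubical set $P$ is a family of sets $(P_n)_{n\ge0}$ with face maps $d^k_i:P_n\to P_{n-1}$ ($n>0$, $k\in\{0,1\}$, $1\le i\le n$) satisfying $d^k_id^l_j=d^l_{j-1}d^k_i$ for $i<j$; morphisms commute with faces; composites of face maps are applied right to left; $P_{\le1}$ is the 1-skeleton and $f_{\le1}$ the restriction of a morphism $f$ to it. Tensor product: $(P\otimes Q)_n=\coprod_{p+q=n}P_p\times Q_q$ with $d^k_i(a,b)=(d^k_ia,b)$ for $i\le p$ and $(a,d^k_{i-p}b)$ for $i>p$. $\llbracket0,1\rrbracket$ has vertices $0,1$ and one edge from $0$ to $1$; $\llbracket0,1\rrbracket^{\otimes n}$ is its $n$-fold tensor power with unique $n$-cube $\iota_n$; for $x\in P_n$, $x_\sharp:\llbracket0,1\rrbracket^{\otimes n}\to P$ is the unique morphism with $x_\sharp(\iota_n)=x$. An HDA is $\mathcal{A}=(P_\mathcal{A},I_\mathcal{A},F_\mathcal{A},\Sigma_\mathcal{A},\lambda_\mathcal{A})$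 with $\lambda_\mathcal{A}:(P_\mathcal{A})_1\to\Sigma_\mathcal{A}$ and $\lambda_\mathcal{A}(d^0_iz)=\lambda_\mathcal{A}(d^1_iz)$ for 2-cubes $z$, $i=1,2$; $\mathcal{A}_{\le1}$ keeps cubes of degree $\le1$. A transition system is an HDA without cubes of degree $\ge2$ in which two edges with equal label, equal $d^0_1$ and equal $d^1_1$ coincide. A $\ltimes$-transition system $\mathcal{T}$ is a transition system $U(\mathcal{T})$ with a binary relation $\ltimes_\mathcal{T}$ on its label set; it is deterministic if any two edges with the same label and the same $d^0_1$ are equal. Asymmetric: $\alpha\ltimes\beta$ implies not $\beta\ltimes\alpha$. Conditions: (HM1) $\mathcal{A}_{\le1}=U(\mathcal{T})$; (HM2) for all $z\in(P_\mathcal{A})_2$, $\lambda_\mathcal{A}(d^0_2z)\ltimes_\mathcal{T}\lambda_\mathcal{A}(d^0_1z)$. -}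

module Defs where

open import Data.Nat using (ℕ; zero; suc; _≤_)
open import Data.Fin using (Fin; zero; suc; toℕ; inject₁; fromℕ)
open import Data.Bool using (Bool; true; false)
open import Data.Unit using (⊤; tt)
open import Data.Empty using (⊥)
open import Data.Product using (_×_; _,_; Σ; ∃)
open import Data.Sum using (_⊎_; inj₁; inj₂)
open import Data.Maybe using (Maybe; just; nothing)
import Data.Maybe as Maybe
open import Relation.Nullary using (¬_)
open import Relation.Binary.PropositionalEquality using (_≡_; subst; cong; sym)

-- Conventions: face indices are 0-based, i.e. the Agda index i : Fin (suc n)
-- stands for the paper's index i+1 ∈ {1,…,n+1}.  Bool encodes k ∈ {0,1}
-- (false = 0, true = 1).

record Graded : Set₁ where
  field
    Cell : ℕ → Set
    face : ∀ {n} → Bool → Fin (suc n) → Cell (suc n) → Cell n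

open Graded public

-- Precubical set: graded set with faces satisfying
-- d^k_i d^l_j = d^l_{j-1} d^k_i for i < j (paper indices).
-- With 0-based i j : Fin (suc n), i ≤ j, the paper's indices are
-- i+1 < j+2.
record PrecubicalSet : Set₁ where
  field
    graded : Graded
    cubical : ∀ {n} (k l : Bool) (i j : Fin (suc n)) → toℕ i ≤ toℕ j →
              (z : Cell graded (suc (suc n))) →
              face graded k i (face graded l (suc j) z)
                ≡ face graded l j (face graded k (inject₁ i) z)

open PrecubicalSet public

record Morphism (C D : Graded) : Set where
  field
    map  : ∀ n → Cell C n → Cell D n
    comm : ∀ n (k : Bool) (i : Fin (suc n)) (z : Cell C (suc n)) →
           map n (face C k i z) ≡ face D k i (map (suc n) z)

open Morphism public

-- The tensor power ⟦0,1⟧^{⊗n}, unfolded: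
-- ⟦0,1⟧^{⊗ (suc n)} = ⟦0,1⟧ ⊗ ⟦0,1⟧^{⊗ n}, ⟦0,1⟧^{⊗ 0} = one point.
-- Degree-k cells of ⟦0,1⟧ ⊗ Q are (vertex b ∈ Bool) × Q_k ⊔ (the edge) × Q_{k-1}.

Cube : ℕ → ℕ → Set
Cube zero    zero    = ⊤
Cube zero    (suc k) = ⊥
Cube (suc n) zero    = Bool × Cube n zero
Cube (suc n) (suc k) = (Bool × Cube n (suc k)) ⊎ Cube n k

vtx : ∀ {n k} → Bool → Cube n k → Cube (suc n) k
vtx {k = zero}  b w = b , w
vtx {k = suc k} b w = inj₁ (b , w)

-- tensor-product face maps: d^k_i (a , w) = (d^k_i a , w) if i ≤ dim a,
-- (a , d^k_{i - dim a} w) otherwise.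
cubeFace : ∀ {n k} → Bool → Fin (suc k) → Cube n (suc k) → Cube n k
cubeFace {suc n}          b i       (inj₁ (c , w)) = vtx c (cubeFace b i w)
cubeFace {suc n}          b zero    (inj₂ w)       = vtx b w
cubeFace {suc n} {suc k}  b (suc i) (inj₂ w)       = inj₂ (cubeFace b i w)

Interval⊗ : ℕ → Graded
Interval⊗ n = record { Cell = Cube n ; face = cubeFace }

ι : ∀ n → Cube n n
ι zero    = tt
ι (suc n) = inj₂ (ι n)

record HDA : Set₁ where
  field
    P   : PrecubicalSet
    I   : Cell (graded P) 0 → Set
    F   : Cell (graded P) 0 → Set
    Lab : Set
    lab : Cell (graded P) 1 → Lab
    lab-coh : ∀ (z : Cell (graded P) 2) (i : Fin 2) →
              lab (face (graded P) false i z) ≡ lab (face (graded P) true i z)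

open HDA public

Cell≤1 : PrecubicalSet → ℕ → Set
Cell≤1 P zero          = Cell (graded P) 0
Cell≤1 P (suc zero)    = Cell (graded P) 1
Cell≤1 P (suc (suc n)) = ⊥

face≤1 : ∀ (P : PrecubicalSet) {n} → Bool → Fin (suc n) → Cell≤1 P (suc n) → Cell≤1 P n
face≤1 P {zero}  k i z = face (graded P) k i z
face≤1 P {suc n} k i ()

skel≤1 : PrecubicalSet → PrecubicalSet
skel≤1 P = record
  { graded  = record { Cell = Cell≤1 P ; face = face≤1 P }
  ; cubical = λ k l i j _ () }

HDA≤1 : HDA → HDA
HDA≤1 A = record
  { P = skel≤1 (P A) ; I = I A ; F = F A ; Lab = Lab A ; lab = lab A
  ; lab-coh = λ () }

Cl : HDA → ℕ → Set
Cl A = Cell (graded (P A))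

d : (A : HDA) → ∀ {n} → Bool → Fin (suc n) → Cl A (suc n) → Cl A n
d A = face (graded (P A))

IsTransitionSystem : HDA → Set
IsTransitionSystem A =
  (∀ n → ¬ Cl A (suc (suc n))) ×
  (∀ (e e' : Cl A 1) → lab A e ≡ lab A e' →
     d A false zero e ≡ d A false zero e' →
     d A true zero e ≡ d A true zero e' → e ≡ e')

record ⋉TS : Set₁ where
  field
    U    : HDA
    isTS : IsTransitionSystem U
    ⋉    : Lab U → Lab U → Set

open ⋉TS public

Deterministic : ⋉TS → Set
Deterministic T = ∀ (e e' : Cl (U T) 1) → lab (U T) e ≡ lab (U T) e' →
  d (U T) false zero e ≡ d (U T) false zero e' → e ≡ e'

Asymmetric : ⋉TS → Set
Asymmetric T = ∀ α β → ⋉ T α β → ¬ ⋉ T β α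

HM1 : HDA → ⋉TS → Set₁
HM1 A T = HDA≤1 A ≡ U T

labT : (A : HDA) (T : ⋉TS) → HM1 A T → Lab A → Lab (U T)
labT A T hm1 = subst (λ X → X) (cong Lab hm1)

HM2 : (A : HDA) (T : ⋉TS) → HM1 A T → Set
HM2 A T hm1 = ∀ (z : Cl A 2) →
  ⋉ T (labT A T hm1 (lab A (d A false (suc zero) z)))
      (labT A T hm1 (lab A (d A false zero z)))

-- pre m z = d^0_1 ⋯ d^0_m z  for z ∈ P_{m+1}
pre : (A : HDA) → ∀ m → Cl A (suc m) → Cl A 1
pre A zero    z = z
pre A (suc m) z = pre A m (d A false (inject₁ (fromℕ m)) z)

unlast : ∀ {n} → Fin (suc n) → Maybe (Fin n)
unlast {zero}  zero    = nothing
unlast {suc n} zero    = just zero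
unlast {suc n} (suc i) = Maybe.map suc (unlast i)

-- edgeS i x = d^0_1 ⋯ d^0_i d^0_{i+2} ⋯ d^0_{n+1} x  (0-based i),
-- applied right to left: first d^0_{n+1}, …
edgeS : (A : HDA) → ∀ {n} → Fin (suc n) → Cl A (suc n) → Cl A 1
edgeS A {zero}  i x = pre A zero x
edgeS A {suc n} i x with unlast i
... | nothing = pre A (suc n) x
... | just j  = edgeS A j (d A false (fromℕ (suc n)) x)

edge : (A : HDA) → ∀ {n} → Fin n → Cl A n → Cl A 1
edge A {suc n} i x = edgeS A i x

SameEdgeSet : (A : HDA) → ∀ {n} → Cl A n → Cl A n → Set
SameEdgeSet A {n} x y =
  (∀ (i : Fin n) → ∃ λ (j : Fin n) → edge A i x ≡ edge A j y) ×
  (∀ (j : Fin n) → ∃ λ (i : Fin n) → edge A j y ≡ edge A i x)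

Eq≤1 : ∀ {C D : Graded} → Morphism C D → Morphism C D → Set
Eq≤1 {C} f g = (∀ (v : Cell C 0) → map f 0 v ≡ map g 0 v) ×
               (∀ (e : Cell C 1) → map f 1 e ≡ map g 1 e)

-- The edges d⁰⋯d⁰x of the hypothesis are the images under x♯ of the n axes of the cube at
-- its origin.  For i < j the axes i and j span a square, so (HM2) makes the labels of these
-- edges a strict ⋉-chain in the order of the axes, and likewise for y.  Two strict chains for
-- an asymmetric relation with the same set of members agree index by index, so x♯ and y♯ agree
-- on the axes, hence on the origin.  Opposite edges of a square have equal labels, so every edge
-- of the cube carries the label of the axis it is parallel to; determinism of 𝒯 (transported
-- to 𝒜 by (HM1)) then propagates agreement from the origin along the whole 1-skeleton.
module Submission where

open import Defs
open import Data.Nat using (ℕ; zero; suc; _≤_; z≤n; s≤s)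
open import Data.Nat.Properties using (≤-<-trans; ≤-antisym; ≤-refl)
open import Data.Fin using (Fin; zero; suc; toℕ; inject₁; fromℕ; _<_)
open import Data.Fin.Properties using (toℕ-injective; toℕ-inject₁; <-cmp; <-irrefl; ≤̄⇒inject₁<)
open import Data.Fin.Induction using (<-weakInduction)
open import Data.Bool using (Bool; true; false)
open import Data.Unit using (tt)
open import Data.Empty using (⊥-elim)
open import Data.Product using (_×_; _,_; Σ; ∃; proj₁; proj₂)
open import Data.Sum using (inj₁; inj₂)
open import Data.Maybe using (just; nothing)
open import Function using (_∘_)
open import Function.Definitions using (Injective)
open import Relation.Binary.Core using (_Preserves_⟶_)
open import Relation.Binary.Definitions using (tri<; tri≈; tri>)
import Relation.Binary.Definitions as Rel
open import Relation.Binary.PropositionalEquality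
  using (_≡_; refl; sym; trans; cong; subst; subst₂; module ≡-Reasoning)

strictMono⇒inflationary : ∀ {n} {σ : Fin n → Fin n} → σ Preserves _<_ ⟶ _<_ →
                          ∀ i → toℕ i ≤ toℕ (σ i)
strictMono⇒inflationary {zero}      _    ()
strictMono⇒inflationary {suc n} {σ} mono = <-weakInduction (λ i → toℕ i ≤ toℕ (σ i)) z≤n step
  where
  step : ∀ i → toℕ (inject₁ i) ≤ toℕ (σ (inject₁ i)) → toℕ (suc i) ≤ toℕ (σ (suc i))
  step i ih = subst (_≤ toℕ (σ (suc i))) (cong suc (toℕ-inject₁ i))
                    (≤-<-trans ih (mono (≤̄⇒inject₁< ≤-refl)))

module StrictChains {X L : Set} {_⊏_ : L → L → Set} (⊏-asym : Rel.Asymmetric _⊏_) (lb : X → L) where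

  IsStrictChain : ∀ {n} → (Fin n → X) → Set
  IsStrictChain E = (lb ∘ E) Preserves _<_ ⟶ _⊏_

  chain-injective : ∀ {n} {E : Fin n → X} → IsStrictChain E → Injective _≡_ _≡_ (lb ∘ E)
  chain-injective {E = E} chain {i} {j} lbEi≡lbEj with <-cmp i j
  ... | tri< i<j _ _ = ⊥-elim (⊏-asym r r) where r = subst (lb (E i) ⊏_) (sym lbEi≡lbEj) (chain i<j)
  ... | tri≈ _ i≡j _ = i≡j
  ... | tri> _ _ j<i = ⊥-elim (⊏-asym r r) where r = subst (_⊏ lb (E i)) (sym lbEi≡lbEj) (chain j<i)

  reindexing-strictMono : ∀ {n} {E E′ : Fin n → X} {σ : Fin n → Fin n} →
                          IsStrictChain E → IsStrictChain E′ → (∀ i → E i ≡ E′ (σ i)) →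
                          σ Preserves _<_ ⟶ _<_
  reindexing-strictMono {E = E} {E′} {σ} chain chain′ E≡E′∘σ {i} {j} i<j with <-cmp (σ i) (σ j)
  ... | tri< σi<σj _ _ = σi<σj
  ... | tri≈ _ σi≡σj _ = ⊥-elim (<-irrefl (chain-injective chain (cong lb (begin
          E i      ≡⟨ E≡E′∘σ i ⟩
          E′ (σ i) ≡⟨ cong E′ σi≡σj ⟩
          E′ (σ j) ≡⟨ E≡E′∘σ j ⟨
          E j      ∎))) i<j)
    where open ≡-Reasoning
  ... | tri> _ _ σj<σi = ⊥-elim (⊏-asym (chain′ σj<σi)
          (subst₂ _⊏_ (cong lb (E≡E′∘σ i)) (cong lb (E≡E′∘σ j)) (chain i<j)))

  -- The reindexing σ of one chain into the other is inflationary, and so is the reverse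
  -- reindexing τ; since τ ∘ σ = id by injectivity, i ≤ σ i ≤ τ (σ i) = i.
  same-image⇒≡ : ∀ {n} {E E′ : Fin n → X} → IsStrictChain E → IsStrictChain E′ →
                 (∀ i → ∃ λ j → E i ≡ E′ j) → (∀ j → ∃ λ i → E′ j ≡ E i) →
                 ∀ i → E i ≡ E′ i
  same-image⇒≡ {n} {E} {E′} chain chain′ E⊆E′ E′⊆E i = trans (E≡E′∘σ i) (cong E′ σi≡i)
    where
    σ τ : Fin n → Fin n
    σ = proj₁ ∘ E⊆E′
    τ = proj₁ ∘ E′⊆E
    E≡E′∘σ : ∀ i → E i ≡ E′ (σ i)
    E≡E′∘σ = proj₂ ∘ E⊆E′
    E′≡E∘τ : ∀ j → E′ j ≡ E (τ j)
    E′≡E∘τ = proj₂ ∘ E′⊆E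
    τσi≡i : τ (σ i) ≡ i
    τσi≡i = chain-injective chain (cong lb (sym (trans (E≡E′∘σ i) (E′≡E∘τ (σ i)))))
    σi≡i : σ i ≡ i
    σi≡i = toℕ-injective (≤-antisym
      (subst (λ k → toℕ (σ i) ≤ toℕ k) τσi≡i
             (strictMono⇒inflationary (reindexing-strictMono chain′ chain E′≡E∘τ) (σ i)))
      (strictMono⇒inflationary (reindexing-strictMono chain chain′ E≡E′∘σ) i))

origin : ∀ n → Cube n 0
origin zero    = tt
origin (suc n) = false , origin n

axis : ∀ n → Fin n → Cube n 1
axis (suc n) zero    = inj₂ (origin n)
axis (suc n) (suc i) = inj₁ (false , axis n i)

axis-source : ∀ n (i : Fin n) → cubeFace false zero (axis n i) ≡ origin n
axis-source (suc n) zero    = refl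
axis-source (suc n) (suc i) = cong (false ,_) (axis-source n i)

axis-square : ∀ n {i j : Fin n} → i < j →
              Σ (Cube n 2) λ s → cubeFace false (suc zero) s ≡ axis n i
                               × cubeFace false zero s ≡ axis n j
axis-square (suc n) {zero}  {suc j} _         = inj₂ (axis n j) , cong inj₂ (axis-source n j) , refl
axis-square (suc n) {suc i} {suc j} (s≤s i<j) with axis-square n i<j
... | s , d⁰₂s≡ , d⁰₁s≡ = inj₁ (false , s) , cong (vtx false) d⁰₂s≡ , cong (vtx false) d⁰₁s≡

cubePre : ∀ {N} m → Cube N (suc m) → Cube N 1
cubePre zero    z = z
cubePre (suc m) z = cubePre m (cubeFace false (inject₁ (fromℕ m)) z)

cubeEdge : ∀ {N k} → Fin (suc k) → Cube N (suc k) → Cube N 1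
cubeEdge {k = zero}  i x = x
cubeEdge {k = suc k} i x with unlast i
... | nothing = cubePre (suc k) x
... | just j  = cubeEdge j (cubeFace false (fromℕ (suc k)) x)

cubeSource : ∀ {N k} → Cube N k → Cube N 0
cubeSource {k = zero}  w = w
cubeSource {k = suc k} w = cubeSource (cubeFace false (fromℕ k) w)

cubePre-inj₂ : ∀ {N} m (w : Cube N (suc m)) → cubePre {suc N} (suc m) (inj₂ w) ≡ vtx false (cubePre m w)
cubePre-inj₂ zero    w = refl
cubePre-inj₂ (suc m) w = cubePre-inj₂ m (cubeFace false (inject₁ (fromℕ m)) w)

cubeSource-inj₂ : ∀ {N} k (w : Cube N k) → cubeSource {suc N} {suc k} (inj₂ w) ≡ vtx false (cubeSource w)
cubeSource-inj₂ zero    w = refl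
cubeSource-inj₂ (suc k) w = cubeSource-inj₂ k (cubeFace false (fromℕ k) w)

cubeEdge-zero-inj₂ : ∀ {N} k (w : Cube N k) → cubeEdge {suc N} {k} zero (inj₂ w) ≡ inj₂ (cubeSource w)
cubeEdge-zero-inj₂ zero    w = refl
cubeEdge-zero-inj₂ (suc k) w = cubeEdge-zero-inj₂ k (cubeFace false (fromℕ k) w)

cubeEdge-suc-inj₂ : ∀ {N} k (i : Fin (suc k)) (w : Cube N (suc k)) →
                    cubeEdge {suc N} {suc k} (suc i) (inj₂ w) ≡ vtx false (cubeEdge i w)
cubeEdge-suc-inj₂ zero    zero w = refl
cubeEdge-suc-inj₂ (suc k) i    w with unlast i
... | nothing = cubePre-inj₂ (suc k) w
... | just j  = cubeEdge-suc-inj₂ k j (cubeFace false (fromℕ (suc k)) w)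

cubeSource-ι : ∀ n → cubeSource (ι n) ≡ origin n
cubeSource-ι zero    = refl
cubeSource-ι (suc n) = trans (cubeSource-inj₂ n (ι n)) (cong (false ,_) (cubeSource-ι n))

cubeEdge-ι : ∀ n (i : Fin (suc n)) → cubeEdge i (ι (suc n)) ≡ axis (suc n) i
cubeEdge-ι n       zero    = trans (cubeEdge-zero-inj₂ n (ι n)) (cong inj₂ (cubeSource-ι n))
cubeEdge-ι (suc n) (suc i) = trans (cubeEdge-suc-inj₂ n i (ι (suc n))) (cong (vtx false) (cubeEdge-ι n i))

edge-invariant⇒constant : ∀ n {X : Set} (φ : Cube n 0 → X) →
                          (∀ e → φ (cubeFace false zero e) ≡ φ (cubeFace true zero e)) →
                          ∀ w → φ w ≡ φ (origin n)
edge-invariant⇒constant zero    φ inv tt          = refl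
edge-invariant⇒constant (suc n) φ inv (false , w) =
  edge-invariant⇒constant n (φ ∘ (false ,_)) (λ e → inv (inj₁ (false , e))) w
edge-invariant⇒constant (suc n) φ inv (true , w)  =
  trans (edge-invariant⇒constant n (φ ∘ (true ,_)) (λ e → inv (inj₁ (true , e))) w)
        (sym (inv (inj₂ (origin n))))

restrict : ∀ {n D} → Morphism (Interval⊗ (suc n)) D → Bool → Morphism (Interval⊗ n) D
restrict f b = record { map = λ k w → map f k (vtx b w) ; comm = λ k c i z → comm f k c i (vtx b z) }

LabelDeterministic : HDA → Set
LabelDeterministic A = ∀ (e e′ : Cl A 1) → lab A e ≡ lab A e′ →
                       d A false zero e ≡ d A false zero e′ → e ≡ e′

deterministic-from-skeleton : ∀ {A B} → HDA≤1 A ≡ B → LabelDeterministic B → LabelDeterministic A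
deterministic-from-skeleton refl det = det

module _ (A : HDA) where

  private G = graded (P A)

  pre-map : ∀ {N} (h : Morphism (Interval⊗ N) G) m (z : Cube N (suc m)) →
            pre A m (map h (suc m) z) ≡ map h 1 (cubePre m z)
  pre-map h zero    z = refl
  pre-map h (suc m) z =
    trans (cong (pre A m) (sym (comm h (suc m) false (inject₁ (fromℕ m)) z)))
          (pre-map h m (cubeFace false (inject₁ (fromℕ m)) z))

  edgeS-map : ∀ {N k} (h : Morphism (Interval⊗ N) G) (i : Fin (suc k)) (z : Cube N (suc k)) →
              edgeS A i (map h (suc k) z) ≡ map h 1 (cubeEdge i z)
  edgeS-map {k = zero}  h i z = refl
  edgeS-map {k = suc k} h i z with unlast i
  ... | nothing = pre-map h (suc k) z
  ... | just j  = trans (cong (edgeS A j) (sym (comm h (suc k) false (fromℕ (suc k)) z)))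
                        (edgeS-map h j (cubeFace false (fromℕ (suc k)) z))

  edge-image-ι : ∀ {n} (h : Morphism (Interval⊗ (suc n)) G) (i : Fin (suc n)) →
                 edge A i (map h (suc n) (ι (suc n))) ≡ map h 1 (axis (suc n) i)
  edge-image-ι {n} h i = trans (edgeS-map h i (ι (suc n))) (cong (map h 1) (cubeEdge-ι n i))

  lab-opposite : ∀ {C} (h : Morphism C G) (s : Cell C 2) (i : Fin 2) →
                 lab A (map h 1 (face C false i s)) ≡ lab A (map h 1 (face C true i s))
  lab-opposite {C} h s i = begin
    lab A (map h 1 (face C false i s)) ≡⟨ cong (lab A) (comm h 1 false i s) ⟩
    lab A (d A false i (map h 2 s))    ≡⟨ lab-coh A (map h 2 s) i ⟩
    lab A (d A true i (map h 2 s))     ≡⟨ cong (lab A) (comm h 1 true i s) ⟨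
    lab A (map h 1 (face C true i s))  ∎
    where open ≡-Reasoning

  -- Two parallel edges of the cube are joined by a chain of squares in which they are opposite.
  lab-determined-by-axes : ∀ n (f g : Morphism (Interval⊗ n) G) →
                           (∀ i → lab A (map f 1 (axis n i)) ≡ lab A (map g 1 (axis n i))) →
                           ∀ e → lab A (map f 1 e) ≡ lab A (map g 1 e)
  lab-determined-by-axes zero    f g axes≡ ()
  lab-determined-by-axes (suc n) f g axes≡ = edges≡
    where
    lower-face≡ : ∀ e → lab A (map f 1 (inj₁ (false , e))) ≡ lab A (map g 1 (inj₁ (false , e)))
    lower-face≡ = lab-determined-by-axes n (restrict f false) (restrict g false) (axes≡ ∘ suc)
    first-axis-label : ∀ (h : Morphism (Interval⊗ (suc n)) G) w →
                       lab A (map h 1 (inj₂ w)) ≡ lab A (map h 1 (axis (suc n) zero))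
    first-axis-label h = edge-invariant⇒constant n (λ v → lab A (map h 1 (inj₂ v)))
                                                   (λ e → lab-opposite h (inj₂ e) (suc zero))
    edges≡ : ∀ e → lab A (map f 1 e) ≡ lab A (map g 1 e)
    edges≡ (inj₁ (false , e)) = lower-face≡ e
    edges≡ (inj₁ (true  , e)) =
      trans (sym (lab-opposite f (inj₂ e) zero)) (trans (lower-face≡ e) (lab-opposite g (inj₂ e) zero))
    edges≡ (inj₂ w) =
      trans (first-axis-label f w) (trans (axes≡ zero) (sym (first-axis-label g w)))

  endpoint-agrees : ∀ {C} (f g : Morphism C G) (b : Bool) (e : Cell C 1) → map f 1 e ≡ map g 1 e →
                    map f 0 (face C b zero e) ≡ map g 0 (face C b zero e)
  endpoint-agrees f g b e e≡ =
    trans (comm f 0 b zero e) (trans (cong (d A b zero) e≡) (sym (comm g 0 b zero e)))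

  module _ (det : LabelDeterministic A) where

    edge-agrees : ∀ {C} (f g : Morphism C G) (e : Cell C 1) →
                  map f 0 (face C false zero e) ≡ map g 0 (face C false zero e) →
                  lab A (map f 1 e) ≡ lab A (map g 1 e) → map f 1 e ≡ map g 1 e
    edge-agrees f g e source≡ lab≡ =
      det _ _ lab≡ (trans (sym (comm f 0 false zero e)) (trans source≡ (comm g 0 false zero e)))

    determined-by-origin-and-labels : ∀ n (f g : Morphism (Interval⊗ n) G) →
      map f 0 (origin n) ≡ map g 0 (origin n) →
      (∀ e → lab A (map f 1 e) ≡ lab A (map g 1 e)) → Eq≤1 f g
    determined-by-origin-and-labels zero    f g origin≡ lab≡ = (λ { tt → origin≡ }) , (λ ())
    determined-by-origin-and-labels (suc n) f g origin≡ lab≡ = vertices≡ , edges≡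
      where
      on-face : ∀ b → map f 0 (b , origin n) ≡ map g 0 (b , origin n) →
                Eq≤1 (restrict f b) (restrict g b)
      on-face b o≡ = determined-by-origin-and-labels n (restrict f b) (restrict g b) o≡
                                                     (λ e → lab≡ (inj₁ (b , e)))
      on-false : Eq≤1 (restrict f false) (restrict g false)
      on-false = on-face false origin≡
      first-axis≡ : map f 1 (inj₂ (origin n)) ≡ map g 1 (inj₂ (origin n))
      first-axis≡ = edge-agrees f g (inj₂ (origin n)) origin≡ (lab≡ (inj₂ (origin n)))
      on-true : Eq≤1 (restrict f true) (restrict g true)
      on-true = on-face true (endpoint-agrees f g true (inj₂ (origin n)) first-axis≡)
      vertices≡ : ∀ v → map f 0 v ≡ map g 0 v
      vertices≡ (false , w) = proj₁ on-false w
      vertices≡ (true  , w) = proj₁ on-true w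
      edges≡ : ∀ e → map f 1 e ≡ map g 1 e
      edges≡ (inj₁ (false , e)) = proj₂ on-false e
      edges≡ (inj₁ (true  , e)) = proj₂ on-true e
      edges≡ (inj₂ w)           = edge-agrees f g (inj₂ w) (proj₁ on-false w) (lab≡ (inj₂ w))

  edges⊆⇒axes⊆ : ∀ {n} (f g : Morphism (Interval⊗ (suc n)) G) →
                 (∀ i → ∃ λ j → edge A i (map f (suc n) (ι (suc n)))
                              ≡ edge A j (map g (suc n) (ι (suc n)))) →
                 ∀ i → ∃ λ j → map f 1 (axis (suc n) i) ≡ map g 1 (axis (suc n) j)
  edges⊆⇒axes⊆ f g f⊆g i with f⊆g i
  ... | j , eq = j , trans (sym (edge-image-ι f i)) (trans eq (edge-image-ι g j))

module _ (A : HDA) (T : ⋉TS) (hm1 : HM1 A T) where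

  _⋉ᴬ_ : Lab A → Lab A → Set
  a ⋉ᴬ b = ⋉ T (labT A T hm1 a) (labT A T hm1 b)

  axis-labels-increase : HM2 A T hm1 → ∀ n (h : Morphism (Interval⊗ n) (graded (P A))) →
                         (lab A ∘ map h 1 ∘ axis n) Preserves _<_ ⟶ _⋉ᴬ_
  axis-labels-increase hm2 n h i<j with axis-square n i<j
  ... | s , d⁰₂s≡ , d⁰₁s≡ =
    subst₂ _⋉ᴬ_ (image-lab (suc zero) d⁰₂s≡) (image-lab zero d⁰₁s≡) (hm2 (map h 2 s))
    where
    image-lab : ∀ k {e} → cubeFace false k s ≡ e →
                lab A (d A false k (map h 2 s)) ≡ lab A (map h 1 e)
    image-lab k refl = cong (lab A) (sym (comm h 1 false k s))

-- The hypothesis 2 ≤ n only serves to exclude n = 0.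
lemma4p8 : (A : HDA) (T : ⋉TS) (hm1 : HM1 A T) → HM2 A T hm1 →
           Deterministic T → Asymmetric T →
           (n : ℕ) → 2 ≤ n → (x y : Cl A n) → SameEdgeSet A x y →
           (x♯ y♯ : Morphism (Interval⊗ n) (graded (P A))) →
           map x♯ n (ι n) ≡ x → map y♯ n (ι n) ≡ y →
           Eq≤1 x♯ y♯
lemma4p8 A T hm1 hm2 det asym zero    ()
lemma4p8 A T hm1 hm2 det asym (suc n) _  x y (x⊆y , y⊆x) x♯ y♯ refl refl =
  determined-by-origin-and-labels A (deterministic-from-skeleton {A} hm1 det) (suc n) x♯ y♯
    origin≡ (lab-determined-by-axes A (suc n) x♯ y♯ (cong (lab A) ∘ axes≡))
  where
  open StrictChains {_⊏_ = _⋉ᴬ_ A T hm1} (λ {a} {b} → asym (labT A T hm1 a) (labT A T hm1 b)) (lab A)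
  axes≡ : ∀ i → map x♯ 1 (axis (suc n) i) ≡ map y♯ 1 (axis (suc n) i)
  axes≡ = same-image⇒≡ (axis-labels-increase A T hm1 hm2 (suc n) x♯)
                       (axis-labels-increase A T hm1 hm2 (suc n) y♯)
                       (edges⊆⇒axes⊆ A x♯ y♯ x⊆y) (edges⊆⇒axes⊆ A y♯ x♯ y⊆x)
  origin≡ : map x♯ 0 (origin (suc n)) ≡ map y♯ 0 (origin (suc n))
  origin≡ = endpoint-agrees A x♯ y♯ false (axis (suc n) zero) (axes≡ zero)
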